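{- Let $k$ be a positive integer. If $S$ is a submonoid of $\mathcal{U}_k$ that contains $\mathfrak{S}_k$, then $S$ is a union of sets of the form $J_\lambda$ ($\lambda$ an integer partition of $k$), i.e. a union of $\mathscr{J}$-classes of $\mathcal{U}_k$.
   Context: Let $[k]=\{1,\dots,k\}$ and $[\bar k]=\{\bar 1,\dots,\bar k\}$. $\mathcal{U}_k$ is the set of set partitions $\pi$ of $[k]\cup[\bar k]$ that are uniform: every block $A$ satisfies $|A\cap[k]|=|A\cap[\bar k]|$. The product $\pi\gamma$ is defined by diagram concatenation: take a copy of $\pi$ on $[k]\cup M$ (with $\bar i$ renamed to a middle vertex $i'$) and a copy of $\gamma$ on $M\cup[\bar k]$ (with $i$ renamed $i'$), where $M=\{1',\dots,k'\}$; take the finest set partition of $[k]\cup M\cup[\bar k]$ coarser than both (connected components), and restrict it to $[k]\cup[\bar k]$. This makes $\mathcal{U}_k$ a monoid. A permutation $\sigma\in\mathfrak{S}_k$ is identified with $\{\{\sigma(i),\bar i\}: i\in[k]\}\in\mathcal{U}_k$; under this identification $\mathfrak{S}_k$ is the group of units. The type of $\pi\in\mathcal{U}_k$ is the integer partition formed by the sorted sizes $|A\cap[k]|$, $A\in\pi$. For an integer partition $\lambda$ of $k$, $J_\lambda=\{\pi\in\mathcal{U}_k:\text{type}(\pi)=\lambda\}$; these are exactly the $\mathscr{J}$-classes of $\mathcal{U}_k$ (elements $x,y$ of a monoid $M$ are $\mathscr{J}$-equivalent if $MxM=MyM$). -}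

module Defs where

open import Data.Nat using (ℕ; zero; suc; _≟_)
open import Data.Nat.Properties using (≤-decTotalOrder)
open import Data.Fin using (Fin; toℕ)
open import Data.Fin.Permutation using (Permutation′; _⟨$⟩ˡ_)
open import Data.Sum using (_⊎_; inj₁; inj₂)
open import Data.List using (List; map; filter; length; deduplicate; allFin; _++_)
open import Data.List.Sort.MergeSort ≤-decTotalOrder using (sort)
open import Data.Product using (_×_)
open import Relation.Binary.PropositionalEquality using (_≡_)
open import Relation.Binary.Construct.Closure.ReflexiveTransitive using (Star)
open import Function.Bundles using (_⇔_)

-- Vertex set [k] ∪ [k̄]:  inj₁ i = top vertex i,  inj₂ i = bottom vertex ī.
Pt : ℕ → Set
Pt k = Fin k ⊎ Fin k

-- A set partition of [k] ∪ [k̄] is represented by a block labelling: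
-- x and y lie in the same block iff they carry the same label.
-- (Every set partition arises this way; two labellings represent the
-- same partition iff they induce the same "same label" relation.)
Labelling : ℕ → Set
Labelling k = Pt k → ℕ

SamePartition : ∀ {k} → Labelling k → Labelling k → Set
SamePartition {k} π ρ = (x y : Pt k) → (π x ≡ π y) ⇔ (ρ x ≡ ρ y)

allPt : (k : ℕ) → List (Pt k)
allPt k = map inj₁ (allFin k) ++ map inj₂ (allFin k)

topCount : ∀ {k} → Labelling k → ℕ → ℕ
topCount {k} π c = length (filter (λ i → π (inj₁ i) ≟ c) (allFin k))

botCount : ∀ {k} → Labelling k → ℕ → ℕ
botCount {k} π c = length (filter (λ i → π (inj₂ i) ≟ c) (allFin k))

Uniform : ∀ {k} → Labelling k → Set
Uniform {k} π = (x : Pt k) → topCount π (π x) ≡ botCount π (π x)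

blockLabels : ∀ {k} → Labelling k → List ℕ
blockLabels {k} π = deduplicate _≟_ (map π (allPt k))

type : ∀ {k} → Labelling k → List ℕ
type π = sort (map (topCount π) (blockLabels π))

-- Diagram concatenation.  Vertices of [k] ∪ M ∪ [k̄]:
data V (k : ℕ) : Set where
  top : Fin k → V k
  mid : Fin k → V k
  bot : Fin k → V k

data Adj {k : ℕ} (π γ : Labelling k) : V k → V k → Set where
  tt : ∀ i j → π (inj₁ i) ≡ π (inj₁ j) → Adj π γ (top i) (top j)
  tm : ∀ i j → π (inj₁ i) ≡ π (inj₂ j) → Adj π γ (top i) (mid j)
  mt : ∀ i j → π (inj₂ i) ≡ π (inj₁ j) → Adj π γ (mid i) (top j)
  mmπ : ∀ i j → π (inj₂ i) ≡ π (inj₂ j) → Adj π γ (mid i) (mid j)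
  mmγ : ∀ i j → γ (inj₁ i) ≡ γ (inj₁ j) → Adj π γ (mid i) (mid j)
  mb : ∀ i j → γ (inj₁ i) ≡ γ (inj₂ j) → Adj π γ (mid i) (bot j)
  bm : ∀ i j → γ (inj₂ i) ≡ γ (inj₁ j) → Adj π γ (bot i) (mid j)
  bb : ∀ i j → γ (inj₂ i) ≡ γ (inj₂ j) → Adj π γ (bot i) (bot j)

Connected : ∀ {k} → Labelling k → Labelling k → V k → V k → Set
Connected π γ = Star (Adj π γ)

outer : ∀ {k} → Pt k → V k
outer (inj₁ i) = top i
outer (inj₂ i) = bot i

IsProduct : ∀ {k} → Labelling k → Labelling k → Labelling k → Set
IsProduct {k} π γ ρ =
  (x y : Pt k) → (ρ x ≡ ρ y) ⇔ Connected π γ (outer x) (outer y)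

-- σ ∈ 𝔖_k as the partition {{σ(i), ī} : i ∈ [k]}:
-- top j gets label σ⁻¹(j), bottom ī gets label i.
permPart : ∀ {k} → Permutation′ k → Labelling k
permPart σ (inj₁ j) = toℕ (σ ⟨$⟩ˡ j)
permPart σ (inj₂ i) = toℕ i

-- The identity of 𝒰_k is the identity
-- permutation, so its membership is covered by the last field.
record SubmonoidContainingSym (k : ℕ) (S : Labelling k → Set) : Set where
  field
    respects  : ∀ π ρ → SamePartition π ρ → S π → S ρ
    ⊆uniform  : ∀ π → S π → Uniform π
    closed    : ∀ π γ ρ → S π → S γ → IsProduct π γ ρ → S ρ
    perms     : ∀ (σ : Permutation′ k) → S (permPart σ)

-- Left multiplication by a permutation relabels the top row of a diagram and
-- right multiplication relabels the bottom row, so the elements of 𝔖_k π 𝔖_k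
-- are exactly the uniform partitions obtained from π by permuting the top and
-- the bottom vertices independently.  Two uniform partitions of the same type
-- are related in this way: match their blocks by a size-preserving bijection,
-- then, in each row separately, the fibres of the two block assignments have
-- the same sizes, hence the rows differ by a permutation.
module Submission where

open import Defs
import Data.Nat
import Data.Nat.Properties
open import Algebra.Properties.CommutativeSemigroup Data.Nat.Properties.+-commutativeSemigroup
  using (x∙yz≈y∙xz)
open import Data.Bool.Base using (if_then_else_)
open import Data.Empty using (⊥-elim)
open import Data.Fin using (Fin; zero; suc; toℕ; punchIn)
open import Data.Fin.Permutation
  using (Permutation′; _⟨$⟩ʳ_; _⟨$⟩ˡ_; inverseˡ; inverseʳ; id; flip; insert; insert-punchIn)
open import Data.Fin.Properties using (toℕ-injective; any?)
open import Data.List using (List; []; _∷_; _++_; map; filter; length; tabulate; allFin)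
open import Data.List.Membership.Propositional using (_∈_)
open import Data.List.Membership.Propositional.Properties
  using (∈-map⁺; ∈-map⁻; ∈-∃++; ∈-++⁺ˡ; ∈-++⁺ʳ; ∈-allFin; ∈-deduplicate⁺; ∈-deduplicate⁻)
open import Data.List.Membership.DecPropositional Data.Nat._≟_ using (_∈?_)
open import Data.List.Properties using (map-cong-local)
open import Data.List.Relation.Binary.Permutation.Propositional
  using (_↭_; ↭-refl; ↭-reflexive; ↭-sym; ↭-trans; ↭-prep; ↭⇒↭ₛ)
open import Data.List.Relation.Binary.Permutation.Propositional.Properties
  using (∈-resp-↭; ¬x∷xs↭[]; shift; drop-∷; map⁺)
import Data.List.Relation.Binary.Permutation.Setoid.Properties as ↭ₛ
import Data.List.Relation.Unary.All as All
import Data.List.Relation.Unary.All.Properties as All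
open import Data.List.Relation.Unary.AllPairs using (_∷_)
open import Data.List.Relation.Unary.Any using (here; there)
open import Data.List.Relation.Unary.Unique.Propositional using (Unique)
open import Data.List.Relation.Unary.Unique.DecPropositional.Properties Data.Nat._≟_
  using (deduplicate-!)
open import Data.List.Sort.MergeSort.Properties Data.Nat.Properties.≤-decTotalOrder using (sort-↭)
open import Data.Nat using (ℕ; zero; suc; _+_)
open import Data.Nat.Properties using (+-cancelˡ-≡)
open import Data.Product using (∃; ∃₂; _×_; _,_)
open import Data.Sum using (inj₁; inj₂; map₁; map₂)
open import Function using (_∘_; _⇔_; mk⇔; Equivalence)
open import Relation.Binary.Construct.Closure.ReflexiveTransitive using (ε; _◅_; _◅◅_; fold; reverse)
open import Relation.Binary.Definitions using (DecidableEquality)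
open import Relation.Binary.PropositionalEquality
  using (_≡_; _≢_; refl; sym; trans; cong; cong₂; subst; setoid; module ≡-Reasoning)
open import Relation.Nullary using (yes; no; does; contradiction)
open import Relation.Nullary.Decidable using (dec-true; dec-false)

module FibreSize {A : Set} (_≟_ : DecidableEquality A) where

  δ : A → A → ℕ
  δ x y = if does (x ≟ y) then 1 else 0

  fibreSize : ∀ {n} → (Fin n → A) → A → ℕ
  fibreSize {zero}  a z = 0
  fibreSize {suc n} a z = δ (a zero) z + fibreSize (a ∘ suc) z

  δ-cong : ∀ {x y z w} → (x ≡ z ⇔ y ≡ w) → δ x z ≡ δ y w
  δ-cong {x} {y} {z} {w} x≡z⇔y≡w with x ≟ z | y ≟ w
  ... | yes _   | yes _   = refl
  ... | no _    | no _    = refl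
  ... | yes x≡z | no y≢w  = contradiction (Equivalence.to x≡z⇔y≡w x≡z) y≢w
  ... | no x≢z  | yes y≡w = contradiction (Equivalence.from x≡z⇔y≡w y≡w) x≢z

  δ-refl : ∀ x → δ x x ≡ 1
  δ-refl x = cong (if_then 1 else 0) (dec-true (x ≟ x) refl)

  fibreSize-cong : ∀ {n} (a b : Fin n → A) {z w} →
    (∀ i → a i ≡ z ⇔ b i ≡ w) → fibreSize a z ≡ fibreSize b w
  fibreSize-cong {zero}  a b e = refl
  fibreSize-cong {suc n} a b e =
    cong₂ _+_ (δ-cong (e zero)) (fibreSize-cong (a ∘ suc) (b ∘ suc) (e ∘ suc))

  fibreSize-empty : ∀ {n} (a : Fin n → A) {z} → (∀ i → a i ≢ z) → fibreSize a z ≡ 0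
  fibreSize-empty {zero}  a a≢z = refl
  fibreSize-empty {suc n} a {z} a≢z =
    cong₂ _+_ (cong (if_then 1 else 0) (dec-false (a zero ≟ z) (a≢z zero)))
              (fibreSize-empty (a ∘ suc) (a≢z ∘ suc))

  fibreSize-punchIn : ∀ {n} (b : Fin (suc n) → A) j z →
    fibreSize b z ≡ δ (b j) z + fibreSize (b ∘ punchIn j) z
  fibreSize-punchIn         b zero    z = refl
  fibreSize-punchIn {suc n} b (suc j) z =
    trans (cong (δ (b zero) z +_) (fibreSize-punchIn (b ∘ suc) j z))
          (x∙yz≈y∙xz (δ (b zero) z) (δ (b (suc j)) z) _)

  length-filter-tabulate : ∀ {B : Set} {n} (a : B → A) (g : Fin n → B) z →
    length (filter (λ x → a x ≟ z) (tabulate g)) ≡ fibreSize (a ∘ g) z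
  length-filter-tabulate {n = zero}  a g z = refl
  length-filter-tabulate {n = suc n} a g z with a (g zero) ≟ z
  ... | yes _ = cong suc (length-filter-tabulate a (g ∘ suc) z)
  ... | no _  = length-filter-tabulate a (g ∘ suc) z

  sameFibres⇒permutation : ∀ {n} (a b : Fin n → A) → (∀ z → fibreSize a z ≡ fibreSize b z) →
    ∃ λ (σ : Permutation′ n) → ∀ i → b (σ ⟨$⟩ʳ i) ≡ a i
  sameFibres⇒permutation {zero}  a b sameFibres = id , λ ()
  sameFibres⇒permutation {suc n} a b sameFibres with any? (λ j → b j ≟ a zero)
  ... | no ∄j with () ← trans (cong (_+ fibreSize (a ∘ suc) (a zero)) (sym (δ-refl (a zero))))
                     (trans (sameFibres (a zero)) (fibreSize-empty b (λ j bj≡a0 → ∄j (j , bj≡a0))))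
  ... | yes (j , bj≡a0) =
    let σ , bσ≡a = sameFibres⇒permutation (a ∘ suc) (b ∘ punchIn j) sameRest in
    insert zero j σ , λ { zero    → bj≡a0
                        ; (suc i) → trans (cong b (insert-punchIn zero j σ i)) (bσ≡a i) }
    where
    sameRest : ∀ z → fibreSize (a ∘ suc) z ≡ fibreSize (b ∘ punchIn j) z
    sameRest z = +-cancelˡ-≡ (δ (a zero) z) _ _
      (trans (sameFibres z) (trans (fibreSize-punchIn b j z) (cong (λ x → δ x z + _) bj≡a0)))

∈⇒↭∷ : ∀ {A : Set} {x : A} {xs} → x ∈ xs → ∃ λ xs′ → xs ↭ x ∷ xs′
∈⇒↭∷ x∈xs with ys , zs , refl ← ∈-∃++ x∈xs = ys ++ zs , shift _ ys zs

Unique-map⇒injectiveOn : ∀ {A B : Set} {h : A → B} {xs} → Unique (map h xs) →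
  ∀ {x y} → x ∈ xs → y ∈ xs → h x ≡ h y → x ≡ y
Unique-map⇒injectiveOn _         (here refl) (here refl) _ = refl
Unique-map⇒injectiveOn (hx∉ ∷ _) (here refl) (there y∈)  e =
  contradiction e (All.lookup (All.map⁻ hx∉) y∈)
Unique-map⇒injectiveOn (hy∉ ∷ _) (there x∈)  (here refl) e =
  contradiction (sym e) (All.lookup (All.map⁻ hy∉) x∈)
Unique-map⇒injectiveOn (_ ∷ u)   (there x∈)  (there y∈)  e = Unique-map⇒injectiveOn u x∈ y∈ e

module _ {A C : Set} (_≟_ : DecidableEquality A) where

  sizePreservingMatching : (f g : A → C) {ls ms : List A} → Unique ls → map f ls ↭ map g ms →
    ∃ λ h → map h ls ↭ ms × (∀ {c} → c ∈ ls → g (h c) ≡ f c)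
  sizePreservingMatching f g {[]} {[]}    _ _ = (λ x → x) , ↭-refl , λ ()
  sizePreservingMatching f g {[]} {_ ∷ _} _ p = ⊥-elim (¬x∷xs↭[] (↭-sym p))
  sizePreservingMatching f g {c ∷ ls} {ms} (c∉ls ∷ uls) p
    with m , m∈ms , fc≡gm ← ∈-map⁻ g (∈-resp-↭ p (here refl))
    with ms′ , ms↭m∷ms′ ← ∈⇒↭∷ m∈ms
    with h′ , h′ls↭ms′ , h′-size ← sizePreservingMatching f g uls
           (drop-∷ (subst (λ y → y ∷ map f ls ↭ map g (m ∷ ms′)) fc≡gm
                          (↭-trans p (map⁺ g ms↭m∷ms′))))
    = h , onto , size
    where
    h : A → A
    h x = if does (x ≟ c) then m else h′ x

    h-c : h c ≡ m
    h-c = cong (if_then m else h′ c) (dec-true (c ≟ c) refl)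

    h-≢ : ∀ {x} → c ≢ x → h x ≡ h′ x
    h-≢ {x} c≢x = cong (if_then m else h′ x) (dec-false (x ≟ c) (c≢x ∘ sym))

    onto : map h (c ∷ ls) ↭ ms
    onto = ↭-trans (↭-reflexive (cong₂ _∷_ h-c (map-cong-local (All.map h-≢ c∉ls))))
                   (↭-trans (↭-prep m h′ls↭ms′) (↭-sym ms↭m∷ms′))

    size : ∀ {x} → x ∈ c ∷ ls → g (h x) ≡ f x
    size (here refl)  = trans (cong g h-c) (sym fc≡gm)
    size (there x∈ls) = trans (cong g (h-≢ (All.lookup c∉ls x∈ls))) (h′-size x∈ls)

module _ {k : ℕ} {π γ : Labelling k} where

  Adj-sym : ∀ {u v} → Adj π γ u v → Adj π γ v u
  Adj-sym (tt i j e)  = tt j i (sym e)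
  Adj-sym (tm i j e)  = mt j i (sym e)
  Adj-sym (mt i j e)  = tm j i (sym e)
  Adj-sym (mmπ i j e) = mmπ j i (sym e)
  Adj-sym (mmγ i j e) = mmγ j i (sym e)
  Adj-sym (mb i j e)  = bm j i (sym e)
  Adj-sym (bm i j e)  = mb j i (sym e)
  Adj-sym (bb i j e)  = bb j i (sym e)

upper lower : ∀ {k} → Pt k → V k
upper (inj₁ i) = top i
upper (inj₂ i) = mid i
lower (inj₁ i) = mid i
lower (inj₂ i) = bot i

module _ {k : ℕ} {π γ : Labelling k} where

  upper-adj : ∀ {x y} → π x ≡ π y → Adj π γ (upper x) (upper y)
  upper-adj {inj₁ i} {inj₁ j} = tt i j
  upper-adj {inj₁ i} {inj₂ j} = tm i j
  upper-adj {inj₂ i} {inj₁ j} = mt i j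
  upper-adj {inj₂ i} {inj₂ j} = mmπ i j

  lower-adj : ∀ {x y} → γ x ≡ γ y → Adj π γ (lower x) (lower y)
  lower-adj {inj₁ i} {inj₁ j} = mmγ i j
  lower-adj {inj₁ i} {inj₂ j} = mb i j
  lower-adj {inj₂ i} {inj₁ j} = bm i j
  lower-adj {inj₂ i} {inj₂ j} = bb i j

  isProduct-intro : ∀ {ρ : Labelling k} (L : V k → ℕ) (r : Pt k → V k) →
    (∀ {u v} → Adj π γ u v → L u ≡ L v) → (∀ x → L (outer x) ≡ ρ x) →
    (∀ x → Connected π γ (outer x) (r x)) → (∀ x y → ρ x ≡ ρ y → Adj π γ (r x) (r y)) →
    IsProduct π γ ρ
  isProduct-intro L r L-adj L-outer reach link x y = mk⇔
    (λ ρx≡ρy → reach x ◅◅ link x y ρx≡ρy ◅ reverse Adj-sym (reach y))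
    (λ conn → trans (sym (L-outer x))
                    (trans (fold (λ u v → L u ≡ L v) (trans ∘ L-adj) refl conn) (L-outer y)))

permPart-top≡bottom : ∀ {k} (τ : Permutation′ k) {i j} →
  permPart τ (inj₁ i) ≡ permPart τ (inj₂ j) → i ≡ τ ⟨$⟩ʳ j
permPart-top≡bottom τ e = trans (sym (inverseʳ τ)) (cong (τ ⟨$⟩ʳ_) (toℕ-injective e))

permPart-isProductˡ : ∀ {k} (σ : Permutation′ k) (π : Labelling k) →
  IsProduct (permPart σ) π (π ∘ map₁ (σ ⟨$⟩ˡ_))
permPart-isProductˡ {k} σ π =
  isProduct-intro L (lower ∘ map₁ (σ ⟨$⟩ˡ_)) L-adj L-outer reach (λ _ _ → lower-adj)
  where
  L : V k → ℕ
  L (top j) = π (inj₁ (σ ⟨$⟩ˡ j))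
  L (mid i) = π (inj₁ i)
  L (bot i) = π (inj₂ i)

  L-adj : ∀ {u v} → Adj (permPart σ) π u v → L u ≡ L v
  L-adj (tt i j e)  = cong (π ∘ inj₁) (toℕ-injective e)
  L-adj (tm i j e)  = cong (π ∘ inj₁) (toℕ-injective e)
  L-adj (mt i j e)  = cong (π ∘ inj₁) (toℕ-injective e)
  L-adj (mmπ i j e) = cong (π ∘ inj₁) (toℕ-injective e)
  L-adj (mmγ i j e) = e
  L-adj (mb i j e)  = e
  L-adj (bm i j e)  = e
  L-adj (bb i j e)  = e

  L-outer : ∀ x → L (outer x) ≡ π (map₁ (σ ⟨$⟩ˡ_) x)
  L-outer (inj₁ j) = refl
  L-outer (inj₂ i) = refl

  reach : ∀ x → Connected (permPart σ) π (outer x) (lower (map₁ (σ ⟨$⟩ˡ_) x))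
  reach (inj₁ j) = tm j (σ ⟨$⟩ˡ j) refl ◅ ε
  reach (inj₂ i) = ε

permPart-isProductʳ : ∀ {k} (π : Labelling k) (τ : Permutation′ k) →
  IsProduct π (permPart τ) (π ∘ map₂ (τ ⟨$⟩ʳ_))
permPart-isProductʳ {k} π τ =
  isProduct-intro L (upper ∘ map₂ (τ ⟨$⟩ʳ_)) L-adj L-outer reach (λ _ _ → upper-adj)
  where
  L : V k → ℕ
  L (top i) = π (inj₁ i)
  L (mid i) = π (inj₂ i)
  L (bot j) = π (inj₂ (τ ⟨$⟩ʳ j))

  L-adj : ∀ {u v} → Adj π (permPart τ) u v → L u ≡ L v
  L-adj (tt i j e)  = e
  L-adj (tm i j e)  = e
  L-adj (mt i j e)  = e
  L-adj (mmπ i j e) = e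
  L-adj (mmγ i j e) = cong (π ∘ inj₂) (trans (permPart-top≡bottom τ e) (inverseʳ τ))
  L-adj (mb i j e)  = cong (π ∘ inj₂) (permPart-top≡bottom τ e)
  L-adj (bm i j e)  = cong (π ∘ inj₂) (sym (permPart-top≡bottom τ (sym e)))
  L-adj (bb i j e)  = cong (π ∘ inj₂ ∘ (τ ⟨$⟩ʳ_)) (toℕ-injective e)

  L-outer : ∀ x → L (outer x) ≡ π (map₂ (τ ⟨$⟩ʳ_) x)
  L-outer (inj₁ i) = refl
  L-outer (inj₂ j) = refl

  reach : ∀ x → Connected π (permPart τ) (outer x) (upper (map₂ (τ ⟨$⟩ʳ_) x))
  reach (inj₁ i) = ε
  reach (inj₂ j) = bm j (τ ⟨$⟩ʳ j) (cong toℕ (sym (inverseˡ τ))) ◅ ε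

open FibreSize Data.Nat._≟_

∈-allPt : ∀ {k} (x : Pt k) → x ∈ allPt k
∈-allPt     (inj₁ i) = ∈-++⁺ˡ (∈-map⁺ inj₁ (∈-allFin i))
∈-allPt {k} (inj₂ i) = ∈-++⁺ʳ (map inj₁ (allFin k)) (∈-map⁺ inj₂ (∈-allFin i))

module _ {k : ℕ} (ρ : Labelling k) where

  ∈-blockLabels : ∀ x → ρ x ∈ blockLabels ρ
  ∈-blockLabels x = ∈-deduplicate⁺ Data.Nat._≟_ (∈-map⁺ ρ (∈-allPt x))

  ∈-blockLabels⁻ : ∀ {c} → c ∈ blockLabels ρ → ∃ λ x → ρ x ≡ c
  ∈-blockLabels⁻ c∈
    with x , _ , c≡ρx ← ∈-map⁻ ρ (∈-deduplicate⁻ Data.Nat._≟_ (map ρ (allPt k)) c∈) = x , sym c≡ρx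

  topCount≡fibreSize : ∀ c → topCount ρ c ≡ fibreSize (ρ ∘ inj₁) c
  topCount≡fibreSize = length-filter-tabulate (ρ ∘ inj₁) (λ i → i)

  botCount≡fibreSize : ∀ c → botCount ρ c ≡ fibreSize (ρ ∘ inj₂) c
  botCount≡fibreSize = length-filter-tabulate (ρ ∘ inj₂) (λ i → i)

  Uniform⇒bottomFibre : Uniform ρ → ∀ {c} → c ∈ blockLabels ρ →
    fibreSize (ρ ∘ inj₂) c ≡ topCount ρ c
  Uniform⇒bottomFibre uniform c∈ with x , refl ← ∈-blockLabels⁻ c∈ =
    trans (sym (botCount≡fibreSize (ρ x))) (sym (uniform x))

blockMatching : ∀ {k} {π γ : Labelling k} → type π ≡ type γ →
  ∃ λ h → map h (blockLabels π) ↭ blockLabels γ ×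
          (∀ {c} → c ∈ blockLabels π → topCount γ (h c) ≡ topCount π c)
blockMatching {π = π} {γ} type≡ =
  sizePreservingMatching Data.Nat._≟_ (topCount π) (topCount γ) (deduplicate-! (map π (allPt _)))
    (↭-trans (↭-sym (sort-↭ _)) (↭-trans (↭-reflexive type≡) (sort-↭ _)))

module _ {k : ℕ} {π γ : Labelling k} {h : ℕ → ℕ}
         (onto : map h (blockLabels π) ↭ blockLabels γ)
         (size : ∀ {c} → c ∈ blockLabels π → topCount γ (h c) ≡ topCount π c) where

  matching-injective : ∀ {c d} → c ∈ blockLabels π → d ∈ blockLabels π → h c ≡ h d → c ≡ d
  matching-injective = Unique-map⇒injectiveOn
    (↭ₛ.Unique-resp-↭ (setoid ℕ) (↭⇒↭ₛ (↭-sym onto)) (deduplicate-! (map γ (allPt k))))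

  matching-sameFibres : (e : Fin k → Pt k) →
    (∀ {c} → c ∈ blockLabels π → fibreSize (π ∘ e) c ≡ topCount π c) →
    (∀ {z} → z ∈ blockLabels γ → fibreSize (γ ∘ e) z ≡ topCount γ z) →
    ∀ z → fibreSize (h ∘ π ∘ e) z ≡ fibreSize (γ ∘ e) z
  matching-sameFibres e πRow γRow z with z ∈? blockLabels γ
  ... | yes z∈ with c , c∈ , z≡hc ← ∈-map⁻ h (∈-resp-↭ (↭-sym onto) z∈) = begin
    fibreSize (h ∘ π ∘ e) z  ≡⟨ fibreSize-cong (h ∘ π ∘ e) (π ∘ e) (λ i → mk⇔
                                  (λ hπ≡z → matching-injective (∈-blockLabels π (e i)) c∈ (trans hπ≡z z≡hc))
                                  (λ π≡c → trans (cong h π≡c) (sym z≡hc))) ⟩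
    fibreSize (π ∘ e) c      ≡⟨ πRow c∈ ⟩
    topCount π c             ≡⟨ sym (size c∈) ⟩
    topCount γ (h c)         ≡⟨ cong (topCount γ) z≡hc ⟨
    topCount γ z             ≡⟨ γRow z∈ ⟨
    fibreSize (γ ∘ e) z      ∎
    where open ≡-Reasoning
  ... | no z∉ = trans (fibreSize-empty (h ∘ π ∘ e) (λ i → missed (hπ∈ i)))
                      (sym (fibreSize-empty (γ ∘ e) (λ i → missed (∈-blockLabels γ (e i)))))
    where
    missed : ∀ {y} → y ∈ blockLabels γ → y ≢ z
    missed y∈ refl = z∉ y∈

    hπ∈ : ∀ i → h (π (e i)) ∈ blockLabels γ
    hπ∈ i = ∈-resp-↭ onto (∈-map⁺ h (∈-blockLabels π (e i)))

samePartition-relabel : ∀ {k} {π γ : Labelling k} (h : ℕ → ℕ) (p : Pt k → Pt k) →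
  (∀ x y → h (π x) ≡ h (π y) → π x ≡ π y) → (∀ x → h (π (p x)) ≡ γ x) →
  SamePartition (π ∘ p) γ
samePartition-relabel h p injective hπp≡γ x y = mk⇔
  (λ e → trans (sym (hπp≡γ x)) (trans (cong h e) (hπp≡γ y)))
  (λ e → injective (p x) (p y) (trans (hπp≡γ x) (trans e (sym (hπp≡γ y)))))

sameType⇒permuted : ∀ {k} {π γ : Labelling k} → Uniform π → Uniform γ → type π ≡ type γ →
  ∃₂ λ (σ τ : Permutation′ k) → SamePartition (π ∘ map₁ (σ ⟨$⟩ˡ_) ∘ map₂ (τ ⟨$⟩ʳ_)) γ
sameType⇒permuted {k} {π} {γ} πUniform γUniform type≡
  with h , onto , size ← blockMatching type≡
  with σ , topRow ← sameFibres⇒permutation (γ ∘ inj₁) (h ∘ π ∘ inj₁)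
         (sym ∘ matching-sameFibres onto size inj₁ (λ {c} _ → sym (topCount≡fibreSize π c))
                                                  (λ {z} _ → sym (topCount≡fibreSize γ z)))
  with τ , bottomRow ← sameFibres⇒permutation (γ ∘ inj₂) (h ∘ π ∘ inj₂)
         (sym ∘ matching-sameFibres onto size inj₂ (Uniform⇒bottomFibre π πUniform)
                                                  (Uniform⇒bottomFibre γ γUniform))
  = flip σ , τ , samePartition-relabel h _
      (λ x y → matching-injective onto size (∈-blockLabels π x) (∈-blockLabels π y))
      λ { (inj₁ j) → topRow j ; (inj₂ j) → bottomRow j }

module _ {k : ℕ} {S : Labelling k → Set} (SM : SubmonoidContainingSym k S) where
  open SubmonoidContainingSym SM

  permuted∈ : ∀ σ τ {π} → S π → S (π ∘ map₁ (σ ⟨$⟩ˡ_) ∘ map₂ (τ ⟨$⟩ʳ_))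
  permuted∈ σ τ {π} π∈S =
    closed _ _ _ (closed _ _ _ (perms σ) π∈S (permPart-isProductˡ σ π))
                 (perms τ) (permPart-isProductʳ _ τ)

lemma5p1 : (n : ℕ) → let k = suc n in
    (S : Labelling k → Set) → SubmonoidContainingSym k S →
    ∀ (π γ : Labelling k) → S π → Uniform γ → type π ≡ type γ → S γ
lemma5p1 n S SM π γ π∈S γUniform type≡ =
  let σ , τ , permuted≈γ = sameType⇒permuted (⊆uniform π π∈S) γUniform type≡
  in respects _ γ permuted≈γ (permuted∈ SM σ τ π∈S)
  where open SubmonoidContainingSym SM
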